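{- Let $P$ be a finite atomic lattice and $\mathcal{M}$ a labeling of $P$. Then $\mathcal{M}$ is a strong coordinatization of $P$ if and only if $\mathcal{M}$ is a weak coordinatization of $P$ and $\triangle(a)=x(a)$ for every $a\in\mathrm{atoms}(P)$.
   Context: A finite atomic lattice is a finite lattice $P$ with least element $0$ and greatest element in which every nonzero element is a join of atoms; $\mathrm{atoms}(P)$ is its set of atoms, and $\mathrm{supp}(p)=\{a\in\mathrm{atoms}(P): a\le p\}$. For $p\in P$, $\lceil p\rceil=\{q: q\ge p\}$ and $\lceil p\rceil^c=P\setminus\lceil p\rceil$. A labeling $\mathcal{M}$ of $P$ assigns a monomial $m_p$ (in a polynomial ring over a field) to each $p\in P$, unlabeled elements having label $1$. Conventions: $\mathrm{lcm}\,\emptyset=\gcd\emptyset=1$. For $a\in\mathrm{atoms}(P)$ let $x(a)=\prod_{p\in\lceil a\rceil^c}m_p$, and let $M_{P,\mathcal{M}}$ be the monomial ideal generated by all $x(a)$. For $p\in P$ let $B_p=\{T\subseteq\mathrm{supp}(p): \bigvee_{b\in T}b=p\}$, and for $a\in\mathrm{atoms}(P)$ let $\triangle(a)=\gcd\{\mathrm{lcm}\{x(b):b\in T\}: T\in\bigcup_{p\ge a}B_p\}$; $I_{P,\mathcal{M}}$ is the monomial ideal generated by all $\triangle(a)$. The lcm-lattice $LCM(I)$ of a monomial ideal $I$ is the set of least common multiples of subsets of its minimal generators, ordered by divisibility. $\mathcal{M}$ is a coordinatization if $LCM(M_{P,\mathcal{M}})\cong P$; it is a strong coordinatization if it is a coordinatization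 and there is a lattice isomorphism $g:P\to LCM(M_{P,\mathcal{M}})$ with $g(a)=x(a)$ for every atom $a$; it is a weak coordinatization if there is a lattice isomorphism $g:P\to LCM(I_{P,\mathcal{M}})$ with $g(a)=\triangle(a)$ for every atom $a$. -}

module Defs where

open import Level using (0ℓ)
open import Data.Nat using (ℕ; _+_; _⊔_; _⊓_)
import Data.Nat as ℕ
open import Data.Bool using (Bool; true; false; if_then_else_)
open import Data.Fin using (Fin; _≟_)
open import Data.Fin.Properties using (all?)
open import Data.List using (List; []; _∷_; foldr; map; concatMap; filter; allFin)
open import Data.List.Relation.Unary.All using (All)
open import Data.Vec using (Vec; zipWith; replicate)
open import Data.Vec.Relation.Binary.Pointwise.Inductive using (Pointwise)
open import Data.Product using (Σ; ∃; _×_; _,_)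
open import Data.Sum using (_⊎_)
open import Relation.Binary.Core using (Rel)
open import Relation.Binary.Definitions using (Decidable)
open import Relation.Binary.PropositionalEquality using (_≡_; _≢_)
open import Relation.Binary.Lattice.Structures using (IsBoundedLattice)
open import Relation.Nullary using (Dec; ¬_; ¬?; yes; no)
open import Relation.Nullary.Decidable using (_×-dec_; _⊎-dec_; _→-dec_; ⌊_⌋)
open import Algebra.Core using (Op₂)
open import Function.Bundles using (_⇔_)

-- Monomials in k variables (over any field): exponent vectors.

Mon : ℕ → Set
Mon k = Vec ℕ k

one : ∀ {k} → Mon k
one = replicate _ 0

_*ᵐ_ : ∀ {k} → Mon k → Mon k → Mon k
_*ᵐ_ = zipWith _+_

lcm₂ : ∀ {k} → Mon k → Mon k → Mon k
lcm₂ = zipWith _⊔_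

gcd₂ : ∀ {k} → Mon k → Mon k → Mon k
gcd₂ = zipWith _⊓_

_∣ᵐ_ : ∀ {k} → Mon k → Mon k → Set
m ∣ᵐ m' = Pointwise ℕ._≤_ m m'

prodL : ∀ {k} → List (Mon k) → Mon k
prodL = foldr _*ᵐ_ one

lcmL : ∀ {k} → List (Mon k) → Mon k
lcmL = foldr lcm₂ one

gcdL : ∀ {k} → List (Mon k) → Mon k
gcdL []           = one
gcdL (m ∷ [])     = m
gcdL (m ∷ m' ∷ ms) = gcd₂ m (gcdL (m' ∷ ms))

InIdeal : ∀ {k} → (Mon k → Set) → Mon k → Set
InIdeal Gen m = ∃ λ g → Gen g × g ∣ᵐ m

MinGen : ∀ {k} → (Mon k → Set) → Mon k → Set
MinGen Gen m = InIdeal Gen m × (∀ m' → InIdeal Gen m' → m' ∣ᵐ m → m' ≡ m)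

InLCM : ∀ {k} → (Mon k → Set) → Mon k → Set
InLCM Gen m = ∃ λ (S : List (Mon _)) → All (MinGen Gen) S × lcmL S ≡ m

IsAtomOf : ∀ {n} → Rel (Fin n) 0ℓ → Fin n → Fin n → Set
IsAtomOf _≤_ ⊥ a = a ≢ ⊥ × (∀ q → q ≤ a → q ≡ ⊥ ⊎ q ≡ a)

joinOf : ∀ {n} → Op₂ (Fin n) → Fin n → List (Fin n) → Fin n
joinOf _∨_ ⊥ = foldr _∨_ ⊥

record FinAtomicLattice : Set₁ where
  field
    n                : ℕ
    _≤_              : Rel (Fin n) 0ℓ
    _≤?_             : Decidable _≤_
    _∨_ _∧_          : Op₂ (Fin n)
    ⊤ ⊥              : Fin n
    isBoundedLattice : IsBoundedLattice _≡_ _≤_ _∨_ _∧_ ⊤ ⊥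
    atomic           : ∀ p → p ≢ ⊥ →
                       ∃ λ (L : List (Fin n)) → All (IsAtomOf _≤_ ⊥) L × joinOf _∨_ ⊥ L ≡ p

  IsAtom : Fin n → Set
  IsAtom = IsAtomOf _≤_ ⊥

  isAtom? : ∀ a → Dec (IsAtom a)
  isAtom? a = ¬? (a ≟ ⊥) ×-dec all? (λ q → q ≤? a →-dec ((q ≟ ⊥) ⊎-dec (q ≟ a)))

  ⋁ : List (Fin n) → Fin n
  ⋁ = joinOf _∨_ ⊥

-- all sublists (= all subsets, when applied to a list without repetitions)
sublists : ∀ {A : Set} → List A → List (List A)
sublists []       = [] ∷ []
sublists (x ∷ xs) = let r = sublists xs in Data.List._++_ (map (x ∷_) r) r

T?-true : (b : Bool) → Dec (b ≡ true)
T?-true true  = yes Relation.Binary.PropositionalEquality.refl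
T?-true false = no (λ ())

allL : ∀ {A : Set} → (A → Bool) → List A → Bool
allL f = foldr (λ a b → Data.Bool._∧_ (f a) b) true

module _ (P : FinAtomicLattice) {k : ℕ} (lab : Fin (FinAtomicLattice.n P) → Mon k) where
  open FinAtomicLattice P

  -- x(a) = ∏_{p ∈ ⌈a⌉^c} m_p
  x : Fin n → Mon k
  x a = prodL (map (λ p → if ⌊ a ≤? p ⌋ then one else lab p) (allFin n))

  inSupp : Fin n → Fin n → Bool
  inSupp p b = Data.Bool._∧_ ⌊ isAtom? b ⌋ ⌊ b ≤? p ⌋

  -- B_p = { T ⊆ supp(p) : ⋁ T = p }
  B : Fin n → List (List (Fin n))
  B p = filter (λ T → T?-true (allL (inSupp p) T) ×-dec (⋁ T ≟ p)) (sublists (allFin n))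

  -- △(a) = gcd { lcm { x(b) : b ∈ T } : T ∈ ⋃_{p ≥ a} B_p }
  △ : Fin n → Mon k
  △ a = gcdL (map (λ T → lcmL (map x T))
                  (concatMap B (filter (λ p → a ≤? p) (allFin n))))

  GenM : Mon k → Set
  GenM m = ∃ λ a → IsAtom a × x a ≡ m

  GenI : Mon k → Set
  GenI m = ∃ λ a → IsAtom a × △ a ≡ m

  -- g : P → LCM(Gen) is a lattice isomorphism (order isomorphism onto LCM(Gen),
  -- both being ordered as posets: P by ≤, LCM by divisibility)
  IsLatIso : (Mon k → Set) → (Fin n → Mon k) → Set
  IsLatIso Gen g = (∀ p → InLCM Gen (g p))
                 × (∀ m → InLCM Gen m → ∃ λ p → g p ≡ m)
                 × (∀ p q → (p ≤ q) ⇔ (g p ∣ᵐ g q))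

  IsCoordinatization : Set
  IsCoordinatization = ∃ λ g → IsLatIso GenM g

  IsStrongCoordinatization : Set
  IsStrongCoordinatization =
    IsCoordinatization × (∃ λ g → IsLatIso GenM g × (∀ a → IsAtom a → g a ≡ x a))

  IsWeakCoordinatization : Set
  IsWeakCoordinatization = ∃ λ g → IsLatIso GenI g × (∀ a → IsAtom a → g a ≡ △ a)

-- Under a strong coordinatization g the monomial lcm{x(b) : b ∈ T} of any set T of atoms is
-- g(q) for some q ≥ ⋁ T, so x(a) = g(a) divides it whenever a ≤ ⋁ T; since T = {a} is one of
-- the sets in the definition of △(a), the gcd △(a) is exactly x(a). Once △ and x agree on the
-- atoms, the ideals M and I have the same generators, so a lattice isomorphism onto LCM(M)
-- sending a to x(a) is the same thing as one onto LCM(I) sending a to △(a).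
module Submission where

open import Defs
open import Data.Nat using (ℕ)
open import Data.Fin using (Fin)
open import Data.Product using (_×_)
open import Relation.Binary.PropositionalEquality using (_≡_)
open import Function.Bundles using (_⇔_)

open import Data.Fin using (_≟_)
import Data.Nat as ℕ
import Data.Nat.Properties as ℕ
open import Data.Vec using ([]; _∷_)
open import Data.Vec.Properties using (zipWith-assoc; zipWith-identityˡ; zipWith-identityʳ)
import Data.Vec.Relation.Binary.Pointwise.Inductive as Pointwise
open import Data.Vec.Relation.Binary.Pointwise.Inductive using ([]; _∷_)
open import Data.List using (List; []; _∷_; [_]; _++_; map; filter; concatMap; allFin)
open import Data.List.Relation.Unary.All as All using (All; []; _∷_)
open import Data.List.Relation.Unary.All.Properties using (++⁺; map⁺)
open import Data.List.Relation.Unary.Any as Any using (here; there)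
open import Data.List.Membership.Propositional using (_∈_; find)
open import Data.List.Membership.Propositional.Properties
  using (∈-map⁺; ∈-map⁻; ∈-++⁺ˡ; ∈-++⁺ʳ; ∈-filter⁺; ∈-filter⁻; ∈-concatMap⁺; ∈-concatMap⁻; ∈-allFin)
open import Data.Product using (∃; _,_; proj₁; proj₂)
open import Data.Bool using (Bool; true; _∧_)
open import Data.Empty using (⊥-elim)
open import Relation.Binary.PropositionalEquality
  using (refl; sym; trans; cong; cong₂; subst; subst₂)
open import Relation.Nullary using (Dec; yes; no)
open import Relation.Nullary.Decidable using (_×-dec_)
open import Relation.Binary.Lattice.Structures using (IsBoundedLattice; IsLattice)
open import Relation.Binary.Structures using (IsPartialOrder)
open import Function.Bundles using (mk⇔; Equivalence)
open import Function.Construct.Symmetry using (⇔-sym)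

∣ᵐ-refl : ∀ {k} {m : Mon k} → m ∣ᵐ m
∣ᵐ-refl = Pointwise.refl ℕ.≤-refl

∣ᵐ-trans : ∀ {k} {l m n : Mon k} → l ∣ᵐ m → m ∣ᵐ n → l ∣ᵐ n
∣ᵐ-trans = Pointwise.trans ℕ.≤-trans

∣ᵐ-antisym : ∀ {k} {m n : Mon k} → m ∣ᵐ n → n ∣ᵐ m → m ≡ n
∣ᵐ-antisym []       []       = refl
∣ᵐ-antisym (p ∷ ps) (q ∷ qs) = cong₂ _∷_ (ℕ.≤-antisym p q) (∣ᵐ-antisym ps qs)

∣ᵐ-lcm₂ˡ : ∀ {k} (m n : Mon k) → m ∣ᵐ lcm₂ m n
∣ᵐ-lcm₂ˡ []      []      = []
∣ᵐ-lcm₂ˡ (a ∷ m) (b ∷ n) = ℕ.m≤m⊔n a b ∷ ∣ᵐ-lcm₂ˡ m n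

∣ᵐ-lcm₂ʳ : ∀ {k} (m n : Mon k) → n ∣ᵐ lcm₂ m n
∣ᵐ-lcm₂ʳ []      []      = []
∣ᵐ-lcm₂ʳ (a ∷ m) (b ∷ n) = ℕ.m≤n⊔m a b ∷ ∣ᵐ-lcm₂ʳ m n

gcd₂-∣ᵐˡ : ∀ {k} (m n : Mon k) → gcd₂ m n ∣ᵐ m
gcd₂-∣ᵐˡ []      []      = []
gcd₂-∣ᵐˡ (a ∷ m) (b ∷ n) = ℕ.m⊓n≤m a b ∷ gcd₂-∣ᵐˡ m n

gcd₂-∣ᵐʳ : ∀ {k} (m n : Mon k) → gcd₂ m n ∣ᵐ n
gcd₂-∣ᵐʳ []      []      = []
gcd₂-∣ᵐʳ (a ∷ m) (b ∷ n) = ℕ.m⊓n≤n a b ∷ gcd₂-∣ᵐʳ m n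

gcd₂-greatest : ∀ {k} {d m n : Mon k} → d ∣ᵐ m → d ∣ᵐ n → d ∣ᵐ gcd₂ m n
gcd₂-greatest []       []       = []
gcd₂-greatest (p ∷ ps) (q ∷ qs) = ℕ.⊓-glb p q ∷ gcd₂-greatest ps qs

lcmL-[_] : ∀ {k} (m : Mon k) → lcmL [ m ] ≡ m
lcmL-[ m ] = zipWith-identityʳ ℕ.⊔-identityʳ m

lcmL-++ : ∀ {k} (ms ns : List (Mon k)) → lcmL (ms ++ ns) ≡ lcm₂ (lcmL ms) (lcmL ns)
lcmL-++ []       ns = sym (zipWith-identityˡ ℕ.⊔-identityˡ (lcmL ns))
lcmL-++ (m ∷ ms) ns =
  trans (cong (lcm₂ m) (lcmL-++ ms ns)) (sym (zipWith-assoc ℕ.⊔-assoc m (lcmL ms) (lcmL ns)))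

∈⇒∣ᵐlcmL : ∀ {k} {m : Mon k} {ms} → m ∈ ms → m ∣ᵐ lcmL ms
∈⇒∣ᵐlcmL {ms = m ∷ ms} (here refl) = ∣ᵐ-lcm₂ˡ m (lcmL ms)
∈⇒∣ᵐlcmL {ms = m ∷ ms} (there p)   = ∣ᵐ-trans (∈⇒∣ᵐlcmL p) (∣ᵐ-lcm₂ʳ m (lcmL ms))

gcdL-∣ᵐ-∈ : ∀ {k} {m : Mon k} {ms} → m ∈ ms → gcdL ms ∣ᵐ m
gcdL-∣ᵐ-∈ {ms = m ∷ []}      (here refl) = ∣ᵐ-refl
gcdL-∣ᵐ-∈ {ms = m ∷ m′ ∷ ms} (here refl) = gcd₂-∣ᵐˡ m (gcdL (m′ ∷ ms))
gcdL-∣ᵐ-∈ {ms = m ∷ m′ ∷ ms} (there p)   = ∣ᵐ-trans (gcd₂-∣ᵐʳ m (gcdL (m′ ∷ ms))) (gcdL-∣ᵐ-∈ p)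

gcdL-greatest : ∀ {k} {d : Mon k} m ms → (∀ {m′} → m′ ∈ m ∷ ms → d ∣ᵐ m′) → d ∣ᵐ gcdL (m ∷ ms)
gcdL-greatest m []        d∣ = d∣ (here refl)
gcdL-greatest m (m′ ∷ ms) d∣ =
  gcd₂-greatest (d∣ (here refl)) (gcdL-greatest m′ ms (λ p → d∣ (there p)))

gcdL-minimum : ∀ {k} {d : Mon k} {ms} → d ∈ ms → (∀ {m} → m ∈ ms → d ∣ᵐ m) → gcdL ms ≡ d
gcdL-minimum {ms = m ∷ ms} d∈ d∣ = ∣ᵐ-antisym (gcdL-∣ᵐ-∈ d∈) (gcdL-greatest m ms d∣)

module _ {k : ℕ} where

  InIdeal-mono : ∀ {Gen Gen′ : Mon k → Set} → (∀ m → Gen m → Gen′ m) →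
                 ∀ {m} → InIdeal Gen m → InIdeal Gen′ m
  InIdeal-mono Gen⇒ (g , Gen-g , g∣m) = g , Gen⇒ g Gen-g , g∣m

  MinGen-resp : ∀ {Gen Gen′ : Mon k → Set} → (∀ m → Gen m ⇔ Gen′ m) →
                ∀ {m} → MinGen Gen m → MinGen Gen′ m
  MinGen-resp Gen⇔ (m∈I , minimal) =
    InIdeal-mono (λ m → Equivalence.to (Gen⇔ m)) m∈I ,
    λ m′ m′∈I′ m′∣m → minimal m′ (InIdeal-mono (λ m → Equivalence.from (Gen⇔ m)) m′∈I′) m′∣m

  InLCM-resp : ∀ {Gen Gen′ : Mon k → Set} → (∀ m → Gen m ⇔ Gen′ m) →
               ∀ {m} → InLCM Gen m → InLCM Gen′ m
  InLCM-resp Gen⇔ (S , minS , lcmS≡m) = S , All.map (MinGen-resp Gen⇔) minS , lcmS≡m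

  IsLatIso-resp : ∀ {Gen Gen′ : Mon k → Set} P (lab : Fin (FinAtomicLattice.n P) → Mon k) {g} →
                  (∀ m → Gen m ⇔ Gen′ m) → IsLatIso P lab Gen g → IsLatIso P lab Gen′ g
  IsLatIso-resp P lab Gen⇔ (g∈LCM , onto , order) =
    (λ p → InLCM-resp Gen⇔ (g∈LCM p)) ,
    (λ m m∈LCM′ → onto m (InLCM-resp (λ m → ⇔-sym (Gen⇔ m)) m∈LCM′)) ,
    order

module _ {k} {Gen : Mon k → Set} where

  InLCM-lcm₂ : ∀ {m n} → InLCM Gen m → InLCM Gen n → InLCM Gen (lcm₂ m n)
  InLCM-lcm₂ (S , minS , refl) (S′ , minS′ , refl) = S ++ S′ , ++⁺ minS minS′ , lcmL-++ S S′

  InLCM-lcmL : ∀ {ms} → All (InLCM Gen) ms → InLCM Gen (lcmL ms)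
  InLCM-lcmL []         = [] , [] , refl
  InLCM-lcmL (m∈ ∷ ms∈) = InLCM-lcm₂ m∈ (InLCM-lcmL ms∈)

[]∈sublists : ∀ {A : Set} (xs : List A) → [] ∈ sublists xs
[]∈sublists []       = here refl
[]∈sublists (x ∷ xs) = ∈-++⁺ʳ (map (x ∷_) (sublists xs)) ([]∈sublists xs)

[_]∈sublists : ∀ {A : Set} {a : A} {xs} → a ∈ xs → [ a ] ∈ sublists xs
[_]∈sublists {xs = x ∷ xs} (here refl) = ∈-++⁺ˡ (∈-map⁺ (x ∷_) ([]∈sublists xs))
[_]∈sublists {xs = x ∷ xs} (there a∈) = ∈-++⁺ʳ (map (x ∷_) (sublists xs)) [ a∈ ]∈sublists

allL-true⁻ : ∀ {A : Set} (f : A → Bool) xs → allL f xs ≡ true → All (λ a → f a ≡ true) xs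
allL-true⁻ f []       _ = []
allL-true⁻ f (a ∷ as) h with f a in fa≡true
... | true = fa≡true ∷ allL-true⁻ f as h

module _ (P : FinAtomicLattice) where
  open FinAtomicLattice P hiding (_∧_)
  open IsBoundedLattice isBoundedLattice using (isLattice; minimum)
  open IsLattice isLattice using (supremum; isPartialOrder)
  open IsPartialOrder isPartialOrder using (antisym) renaming (refl to ≤-refl; trans to ≤-trans)

  ⋁-[_] : ∀ a → ⋁ [ a ] ≡ a
  ⋁-[ a ] = let a≤a∨⊥ , _ , least = supremum a ⊥ in antisym (least a ≤-refl (minimum a)) a≤a∨⊥

  ⋁-least : ∀ {T q} → All (_≤ q) T → ⋁ T ≤ q
  ⋁-least {q = q} []              = minimum q
  ⋁-least {b ∷ T} {q} (b≤q ∷ T≤q) = proj₂ (proj₂ (supremum b (⋁ T))) q b≤q (⋁-least T≤q)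

  module _ {k} (lab : Fin n → Mon k) where

    inSupp-atom : ∀ {p b} → inSupp P lab p b ≡ true → IsAtom b
    inSupp-atom {b = b} _ with isAtom? b
    ... | yes b-atom = b-atom

    inSupp-self : ∀ {a} → IsAtom a → inSupp P lab a a ≡ true
    inSupp-self {a} a-atom with isAtom? a | a ≤? a
    ... | yes _ | yes _  = refl
    ... | no ¬a-atom | _ = ⊥-elim (¬a-atom a-atom)
    ... | yes _ | no a≰a = ⊥-elim (a≰a ≤-refl)

    B-member? : ∀ p T → Dec (allL (inSupp P lab p) T ≡ true × ⋁ T ≡ p)
    B-member? p T = T?-true (allL (inSupp P lab p) T) ×-dec (⋁ T ≟ p)

    ∈-B⁻ : ∀ {p T} → T ∈ B P lab p → All IsAtom T × ⋁ T ≡ p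
    ∈-B⁻ {p} {T} T∈ =
      let _ , T⊆supp , ⋁T≡p = ∈-filter⁻ (B-member? p) {xs = sublists (allFin n)} T∈
      in All.map inSupp-atom (allL-true⁻ (inSupp P lab p) T T⊆supp) , ⋁T≡p

    [_]∈B : ∀ {a} → IsAtom a → [ a ] ∈ B P lab a
    [_]∈B {a} a-atom = ∈-filter⁺ (B-member? a) [ ∈-allFin a ]∈sublists 
      (cong (_∧ true) (inSupp-self a-atom) , ⋁-[ a ])

    △-family : Fin n → List (List (Fin n))
    △-family a = concatMap (B P lab) (filter (a ≤?_) (allFin n))

    ∈-△-family⁻ : ∀ {a T} → T ∈ △-family a → All IsAtom T × a ≤ ⋁ T
    ∈-△-family⁻ {a} T∈ =
      let p , p∈ , T∈Bp   = find (∈-concatMap⁻ (B P lab) {xs = filter (a ≤?_) (allFin n)} T∈)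
          T-atoms , ⋁T≡p = ∈-B⁻ T∈Bp
      in T-atoms , subst (a ≤_) (sym ⋁T≡p) (proj₂ (∈-filter⁻ (a ≤?_) {xs = allFin n} p∈))

    [_]∈△-family : ∀ {a} → IsAtom a → [ a ] ∈ △-family a
    [_]∈△-family {a} a-atom = ∈-concatMap⁺ (B P lab)
      (Any.map (λ { refl → [ a-atom ]∈B }) (∈-filter⁺ (a ≤?_) (∈-allFin a) ≤-refl))

    △≡x-if-x-∣ᵐ : ∀ {a} → IsAtom a →
                  (∀ {T} → All IsAtom T → a ≤ ⋁ T → x P lab a ∣ᵐ lcmL (map (x P lab) T)) →
                  △ P lab a ≡ x P lab a
    △≡x-if-x-∣ᵐ {a} a-atom x∣ = gcdL-minimum x-a∈ x-a-∣ᵐ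
      where
      lcm-x : List (Fin n) → Mon k
      lcm-x T = lcmL (map (x P lab) T)

      x-a∈ : x P lab a ∈ map lcm-x (△-family a)
      x-a∈ = subst (_∈ map lcm-x (△-family a)) lcmL-[ x P lab a ]
                   (∈-map⁺ lcm-x [ a-atom ]∈△-family)

      x-a-∣ᵐ : ∀ {m} → m ∈ map lcm-x (△-family a) → x P lab a ∣ᵐ m
      x-a-∣ᵐ m∈ with ∈-map⁻ lcm-x m∈
      ... | T , T∈ , refl = let T-atoms , a≤⋁T = ∈-△-family⁻ T∈ in x∣ T-atoms a≤⋁T

    GenM⇔GenI : (∀ a → IsAtom a → △ P lab a ≡ x P lab a) → ∀ m → GenM P lab m ⇔ GenI P lab m
    GenM⇔GenI △≡x m = mk⇔ (λ (a , a-atom , x-a≡m) → a , a-atom , trans (△≡x a a-atom) x-a≡m)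
                          (λ (a , a-atom , △-a≡m) → a , a-atom , trans (sym (△≡x a a-atom)) △-a≡m)

    module _ {g} (iso : IsLatIso P lab (GenM P lab) g)
             (g≡x : ∀ a → IsAtom a → g a ≡ x P lab a) where
      private
        g-onto : ∀ m → InLCM (GenM P lab) m → ∃ λ p → g p ≡ m
        g-onto = proj₁ (proj₂ iso)

        g-order : ∀ p q → (p ≤ q) ⇔ (g p ∣ᵐ g q)
        g-order = proj₂ (proj₂ iso)

      lcm-x-∈LCM : ∀ {T} → All IsAtom T → InLCM (GenM P lab) (lcmL (map (x P lab) T))
      lcm-x-∈LCM T-atoms = InLCM-lcmL (map⁺ (All.map x-b∈LCM T-atoms))
        where
        x-b∈LCM : ∀ {b} → IsAtom b → InLCM (GenM P lab) (x P lab b)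
        x-b∈LCM {b} b-atom = subst (InLCM _) (g≡x b b-atom) (proj₁ iso b)

      x-∣ᵐ-lcm-x : ∀ {a T} → IsAtom a → All IsAtom T → a ≤ ⋁ T →
                   x P lab a ∣ᵐ lcmL (map (x P lab) T)
      x-∣ᵐ-lcm-x {a} {T} a-atom T-atoms a≤⋁T with g-onto _ (lcm-x-∈LCM T-atoms)
      ... | q , g-q≡lcm = subst₂ _∣ᵐ_ (g≡x a a-atom) g-q≡lcm
                            (Equivalence.to (g-order a q) (≤-trans a≤⋁T (⋁-least T≤q)))
        where
        T≤q : All (_≤ q) T
        T≤q = All.tabulate λ {b} b∈T → Equivalence.from (g-order b q)
          (subst₂ _∣ᵐ_ (sym (g≡x b (All.lookup T-atoms b∈T))) (sym g-q≡lcm)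
                      (∈⇒∣ᵐlcmL (∈-map⁺ (x P lab) b∈T)))

      △≡x : ∀ a → IsAtom a → △ P lab a ≡ x P lab a
      △≡x a a-atom = △≡x-if-x-∣ᵐ a-atom (x-∣ᵐ-lcm-x a-atom)

lemma3p1 : (P : FinAtomicLattice) (k : ℕ)
           (lab : Fin (FinAtomicLattice.n P) → Mon k) →
           IsStrongCoordinatization P lab
             ⇔ (IsWeakCoordinatization P lab
                 × (∀ a → FinAtomicLattice.IsAtom P a → △ P lab a ≡ x P lab a))
lemma3p1 P k lab = mk⇔ strong⇒weak weak⇒strong
  where
  open FinAtomicLattice P using (IsAtom)

  strong⇒weak : IsStrongCoordinatization P lab →
                IsWeakCoordinatization P lab × (∀ a → IsAtom a → △ P lab a ≡ x P lab a)
  strong⇒weak (_ , g , iso , g≡x) =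
    (g , IsLatIso-resp P lab (GenM⇔GenI P lab △≡x′) iso ,
     λ a a-atom → trans (g≡x a a-atom) (sym (△≡x′ a a-atom))) ,
    △≡x′
    where △≡x′ = △≡x P lab iso g≡x

  weak⇒strong : IsWeakCoordinatization P lab × (∀ a → IsAtom a → △ P lab a ≡ x P lab a) →
                IsStrongCoordinatization P lab
  weak⇒strong ((g , iso , g≡△) , △≡x′) =
    (g , iso′) , g , iso′ , λ a a-atom → trans (g≡△ a a-atom) (△≡x′ a a-atom)
    where iso′ = IsLatIso-resp P lab (λ m → ⇔-sym (GenM⇔GenI P lab △≡x′ m)) iso
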